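{- For $n\geq 0$ let $T_n(x)=\sum_{k\geq 0}T(n,k)x^k$, where $T(n,k)$ is the number of permutations of $[n]$ with exactly $k$ exterior peaks (so $T_0(x)=1$). Then for every $n\geq 1$, \[ T_n(x)=\sum_{j=1}^n\binom{n}{j}(-1)^{j-1}(1-x)^{\lfloor j/2\rfloor}\,T_{n-j}(x). \]
   Context: For a permutation $\pi=\pi_1\pi_2\cdots\pi_n$ of $[n]$, an index $i$ is an exterior peak if either $1<i<n$ and $\pi_{i-1}<\pi_i>\pi_{i+1}$, or $i=1$ (with $n\geq 2$) and $\pi_1>\pi_2$. The empty permutation ($n=0$) has no exterior peaks. -}

module Defs where

open import Data.Nat using (ℕ; zero; suc; _+_; _<ᵇ_; _≡ᵇ_; _∸_)
open import Data.Bool using (Bool; true; false; _∧_; _∨_; not; if_then_else_)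
open import Data.List using (List; []; _∷_; map; concatMap; filterᵇ; length; upTo; sum; applyUpTo)
open import Data.Integer as ℤ using (ℤ; +_)
open import Data.Nat.Combinatorics using (_C_)

-- Permutations of [n] = {1,…,n} in one-line notation π₁π₂⋯πₙ,
-- represented as lists of natural numbers.

range1 : ℕ → List ℕ
range1 n = applyUpTo suc n

words : List ℕ → ℕ → List (List ℕ)
words A zero    = [] ∷ []
words A (suc m) = concatMap (λ a → map (a ∷_) (words A m)) A

elemᵇ : ℕ → List ℕ → Bool
elemᵇ x []       = false
elemᵇ x (y ∷ ys) = (x ≡ᵇ y) ∨ elemᵇ x ys

distinctᵇ : List ℕ → Bool
distinctᵇ []       = true
distinctᵇ (x ∷ xs) = not (elemᵇ x xs) ∧ distinctᵇ xs

perms : ℕ → List (List ℕ)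
perms n = filterᵇ distinctᵇ (words (range1 n) n)

-- Exterior peaks.  Index i is an exterior peak if 1<i<n and
-- π_{i-1} < π_i > π_{i+1}, or i = 1 (n ≥ 2) and π₁ > π₂.

interiorPeaks : List ℕ → ℕ
interiorPeaks (a ∷ b ∷ c ∷ rest) =
  (if (a <ᵇ b) ∧ (c <ᵇ b) then 1 else 0) + interiorPeaks (b ∷ c ∷ rest)
interiorPeaks _ = 0

firstPeak : List ℕ → ℕ
firstPeak (a ∷ b ∷ _) = if b <ᵇ a then 1 else 0
firstPeak _           = 0

extPeaks : List ℕ → ℕ
extPeaks w = firstPeak w + interiorPeaks w

T : ℕ → ℕ → ℕ
T n k = length (filterᵇ (λ π → extPeaks π ≡ᵇ k) (perms n))

-- Polynomials in ℤ[x], represented by their coefficient sequences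
-- ℕ → ℤ (all polynomials used here have finite support).

Poly : Set
Poly = ℕ → ℤ

Σ≤ : ℕ → (ℕ → ℤ) → ℤ
Σ≤ zero    f = f 0
Σ≤ (suc m) f = Σ≤ m f ℤ.+ f (suc m)

Σ1to : ℕ → (ℕ → Poly) → Poly
Σ1to zero    f k = + 0
Σ1to (suc n) f k = Σ1to n f k ℤ.+ f (suc n) k

_⊕_ : Poly → Poly → Poly
(p ⊕ q) k = p k ℤ.+ q k

_⊛_ : Poly → Poly → Poly
(p ⊛ q) k = Σ≤ k (λ i → p i ℤ.* q (k ∸ i))

_·_ : ℤ → Poly → Poly
(c · p) k = c ℤ.* p k

constP : ℤ → Poly
constP c zero    = c
constP c (suc _) = + 0

oneMinusX : Poly
oneMinusX 0 = + 1
oneMinusX 1 = ℤ.- (+ 1)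
oneMinusX _ = + 0

_^P_ : Poly → ℕ → Poly
p ^P zero  = constP (+ 1)
p ^P suc m = p ⊛ (p ^P m)

sgn : ℕ → ℤ
sgn zero    = + 1
sgn (suc m) = ℤ.- sgn m

Tpoly : ℕ → Poly
Tpoly n k = + (T n k)

-- Inserting n + 1 into the n + 1 gaps of a permutation of [n] with p exterior peaks
-- gives 1 + 2p permutations with p peaks and n − 2p with p + 1 peaks (prepending 0
-- makes index 1 an ordinary interior position).  Hence T_{n+1} = T_n + Ψ_n T_n, where
-- Ψ_m Y = m x Y + 2x(1 − x) Y′.  Put a_j = (−1)^j (1 − x)^⌊j/2⌋; then
-- a_{j+1} = −a_j + Ψ_j a_j, and Ψ obeys the product rule Ψ_{i+j}(AB) = (Ψ_i A)B + A(Ψ_j B).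
-- Together with Pascal's rule this gives S_{n+1} = Ψ_n S_n for
-- S_n = Σ_j C(n,j) a_j T_{n−j}.  As S_0 = 1 and Ψ_0 annihilates constants, S_n = 0 for
-- n ≥ 1, which is the identity once the j = 0 term T_n is moved to the other side.

module Submission where

open import Algebra.Bundles using (CommutativeRing)
import Algebra.Solver.Ring
import Algebra.Solver.Ring.AlmostCommutativeRing as ACR
open import Data.Bool using (true; false; _∧_; not; if_then_else_) renaming (T to True)
import Data.Bool.Properties as Bool
open import Data.Empty using (⊥-elim)
open import Data.Integer as ℤ using (ℤ; +_; -_; _+_; _*_)
import Data.Integer.Properties as ℤ
open import Algebra.Properties.CommutativeSemigroup ℤ.+-commutativeSemigroup using (interchange)
open import Data.List using (List; []; _∷_; map; length; _++_; concatMap; filterᵇ)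
import Data.List.Properties as List
open import Data.List.Membership.Propositional using (_∈_; find; lose)
open import Data.List.Membership.Propositional.Properties
  using (∈-concatMap⁺; ∈-concatMap⁻; ∈-map⁺; ∈-map⁻; ∈-filter⁺; ∈-filter⁻; ∈-∃++;
         ∈-applyUpTo⁺; ∈-applyUpTo⁻)
open import Data.List.Membership.Propositional.Properties.WithK using (unique∧set⇒bag)
open import Data.List.Relation.Binary.BagAndSetEquality using (∼bag⇒↭)
open import Data.List.Relation.Binary.Disjoint.Propositional using (Disjoint)
open import Data.List.Relation.Binary.Permutation.Propositional as ↭ using (_↭_; ↭-sym; ↭⇒↭ₛ)
open import Data.List.Relation.Binary.Permutation.Propositional.Properties
  using (All-resp-↭; ↭-length; shift) renaming (map⁺ to ↭-map⁺)
open import Data.List.Relation.Unary.All as All using (All; []; _∷_)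
import Data.List.Relation.Unary.All.Properties as AllP
open import Data.List.Relation.Unary.AllPairs using ([]; _∷_)
open import Data.List.Relation.Unary.Any using (here; there)
open import Data.List.Relation.Unary.Unique.Propositional using (Unique)
import Data.List.Relation.Unary.Unique.Propositional.Properties as Unique
open import Data.Maybe using (Maybe; just; nothing)
open import Data.Nat as ℕ
  using (ℕ; zero; suc; _≤_; _<_; _≥_; z≤n; s≤s; _∸_; _≡ᵇ_; _<ᵇ_; _/_; ⌊_/2⌋)
open import Data.Nat.Combinatorics using (_C_; nCk+nC[k+1]≡[n+1]C[k+1]; k>n⇒nCk≡0)
import Data.Nat.DivMod as ℕ
import Data.Nat.Properties as ℕ
open import Data.List.Membership.DecPropositional ℕ._≟_ using (_∈?_)
open import Data.Product using (_×_; _,_; proj₁; proj₂)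
open import Data.Sum using (_⊎_; inj₁; inj₂)
open import Function using (_∘_)
open import Function.Bundles using (Equivalence; mk⇔)
open import Relation.Binary.PropositionalEquality
open import Data.List.Relation.Binary.Permutation.Setoid.Properties (setoid ℕ) using (Unique-resp-↭)
import Relation.Binary.Reasoning.Setoid as SetoidReasoning
open import Relation.Nullary using (yes; no)
open import Relation.Nullary.Decidable using (T?)

open import Defs

-- Finite sums of coefficients

Σ≤-cong : ∀ k {f g : ℕ → ℤ} → (∀ i → i ≤ k → f i ≡ g i) → Σ≤ k f ≡ Σ≤ k g
Σ≤-cong zero    f≡g = f≡g 0 z≤n
Σ≤-cong (suc k) f≡g =
  cong₂ _+_ (Σ≤-cong k (λ i i≤k → f≡g i (ℕ.m≤n⇒m≤1+n i≤k))) (f≡g (suc k) ℕ.≤-refl)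

Σ≤-+ : ∀ k (f g : ℕ → ℤ) → Σ≤ k (λ i → f i + g i) ≡ Σ≤ k f + Σ≤ k g
Σ≤-+ zero    f g = refl
Σ≤-+ (suc k) f g = trans (cong (_+ (f (suc k) + g (suc k))) (Σ≤-+ k f g))
  (interchange (Σ≤ k f) (Σ≤ k g) (f (suc k)) (g (suc k)))

Σ≤-*ˡ : ∀ k c (f : ℕ → ℤ) → Σ≤ k (λ i → c * f i) ≡ c * Σ≤ k f
Σ≤-*ˡ zero    c f = refl
Σ≤-*ˡ (suc k) c f = trans (cong (_+ c * f (suc k)) (Σ≤-*ˡ k c f)) (sym (ℤ.*-distribˡ-+ c _ _))

Σ≤-*ʳ : ∀ k c (f : ℕ → ℤ) → Σ≤ k (λ i → f i * c) ≡ Σ≤ k f * c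
Σ≤-*ʳ k c f = trans (Σ≤-cong k (λ i _ → ℤ.*-comm (f i) c)) (trans (Σ≤-*ˡ k c f) (ℤ.*-comm c _))

Σ≤-0 : ∀ k (f : ℕ → ℤ) → (∀ i → f i ≡ + 0) → Σ≤ k f ≡ + 0
Σ≤-0 zero    f f≡0 = f≡0 0
Σ≤-0 (suc k) f f≡0 = cong₂ _+_ (Σ≤-0 k f f≡0) (f≡0 (suc k))

Σ≤-shift : ∀ k (f : ℕ → ℤ) → Σ≤ (suc k) f ≡ f 0 + Σ≤ k (f ∘ suc)
Σ≤-shift zero    f = refl
Σ≤-shift (suc k) f = trans (cong (_+ f (suc (suc k))) (Σ≤-shift k f)) (ℤ.+-assoc (f 0) _ _)

Σ≤-head : ∀ k (f : ℕ → ℤ) → (∀ i → f (suc i) ≡ + 0) → Σ≤ k f ≡ f 0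
Σ≤-head zero    f tail≡0 = refl
Σ≤-head (suc k) f tail≡0 =
  trans (Σ≤-shift k f) (trans (cong (_+_ (f 0)) (Σ≤-0 k (f ∘ suc) tail≡0)) (ℤ.+-identityʳ (f 0)))

Σ≤-reverse : ∀ k (f : ℕ → ℤ) → Σ≤ k f ≡ Σ≤ k (λ i → f (k ∸ i))
Σ≤-reverse zero    f = refl
Σ≤-reverse (suc k) f = begin
    Σ≤ k f + f (suc k)                          ≡⟨ cong (_+ f (suc k)) (Σ≤-reverse k f) ⟩
    Σ≤ k (λ i → f (k ∸ i)) + f (suc k)          ≡⟨ ℤ.+-comm _ (f (suc k)) ⟩
    f (suc k) + Σ≤ k (λ i → f (k ∸ i))          ≡⟨ Σ≤-shift k (λ i → f (suc k ∸ i)) ⟨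
    Σ≤ (suc k) (λ i → f (suc k ∸ i))            ∎
  where open ≡-Reasoning

Σ≤-triangle : ∀ k (G : ℕ → ℕ → ℤ) →
  Σ≤ k (λ i → Σ≤ i (λ l → G l (i ∸ l))) ≡ Σ≤ k (λ l → Σ≤ (k ∸ l) (G l))
Σ≤-triangle zero    G = refl
Σ≤-triangle (suc k) G = begin
    Σ≤ k (λ i → Σ≤ i (λ l → G l (i ∸ l))) + (Σ≤ k (λ l → G l (suc k ∸ l)) + G (suc k) (k ∸ k))
      ≡⟨ cong₂ _+_ (Σ≤-triangle k G)
           (cong (λ m → Σ≤ k (λ l → G l (suc k ∸ l)) + G (suc k) m) (ℕ.n∸n≡0 k)) ⟩
    Σ≤ k (λ l → Σ≤ (k ∸ l) (G l)) + (Σ≤ k (λ l → G l (suc k ∸ l)) + G (suc k) 0)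
      ≡⟨ ℤ.+-assoc (Σ≤ k (λ l → Σ≤ (k ∸ l) (G l))) (Σ≤ k (λ l → G l (suc k ∸ l))) (G (suc k) 0) ⟨
    (Σ≤ k (λ l → Σ≤ (k ∸ l) (G l)) + Σ≤ k (λ l → G l (suc k ∸ l))) + G (suc k) 0
      ≡⟨ cong (_+ G (suc k) 0) (Σ≤-+ k (λ l → Σ≤ (k ∸ l) (G l)) (λ l → G l (suc k ∸ l))) ⟨
    Σ≤ k (λ l → Σ≤ (k ∸ l) (G l) + G l (suc k ∸ l)) + G (suc k) 0
      ≡⟨ cong (_+ G (suc k) 0) (Σ≤-cong k extend) ⟩
    Σ≤ k (λ l → Σ≤ (suc k ∸ l) (G l)) + G (suc k) 0
      ≡⟨ cong (λ m → Σ≤ k (λ l → Σ≤ (suc k ∸ l) (G l)) + Σ≤ m (G (suc k))) (ℕ.n∸n≡0 k) ⟨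
    Σ≤ (suc k) (λ l → Σ≤ (suc k ∸ l) (G l)) ∎
  where
  open ≡-Reasoning
  extend : ∀ l → l ≤ k → Σ≤ (k ∸ l) (G l) + G l (suc k ∸ l) ≡ Σ≤ (suc k ∸ l) (G l)
  extend l l≤k rewrite ℕ.+-∸-assoc 1 l≤k = refl

-- The ring ℤ[x]

infix 4 _≈P_
_≈P_ : Poly → Poly → Set
p ≈P q = ∀ k → p k ≡ q k

0P 1P : Poly
0P = constP (+ 0)
1P = constP (+ 1)

0P-coeff : ∀ k → 0P k ≡ + 0
0P-coeff zero    = refl
0P-coeff (suc k) = refl

negP : Poly → Poly
negP p k = - p k

constP-⊛ : ∀ c q → (constP c ⊛ q) ≈P (c · q)
constP-⊛ c q zero    = refl
constP-⊛ c q (suc k) = Σ≤-head (suc k) _ (λ i → refl)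

⊛-comm : ∀ p q → (p ⊛ q) ≈P (q ⊛ p)
⊛-comm p q k = trans (Σ≤-reverse k _) (Σ≤-cong k swap)
  where
  swap : ∀ i → i ≤ k → p (k ∸ i) * q (k ∸ (k ∸ i)) ≡ q i * p (k ∸ i)
  swap i i≤k rewrite ℕ.m∸[m∸n]≡n i≤k = ℤ.*-comm (p (k ∸ i)) (q i)

⊛-assoc : ∀ p q r → ((p ⊛ q) ⊛ r) ≈P (p ⊛ (q ⊛ r))
⊛-assoc p q r k = begin
    Σ≤ k (λ i → Σ≤ i (λ l → p l * q (i ∸ l)) * r (k ∸ i))
  ≡⟨ Σ≤-cong k (λ i _ → sym (Σ≤-*ʳ i (r (k ∸ i)) _)) ⟩
    Σ≤ k (λ i → Σ≤ i (λ l → (p l * q (i ∸ l)) * r (k ∸ i)))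
  ≡⟨ Σ≤-cong k (λ i i≤k → Σ≤-cong i (λ l l≤i → reassociate i l i≤k l≤i)) ⟩
    Σ≤ k (λ i → Σ≤ i (λ l → G l (i ∸ l)))
  ≡⟨ Σ≤-triangle k G ⟩
    Σ≤ k (λ l → Σ≤ (k ∸ l) (G l))
  ≡⟨ Σ≤-cong k (λ l _ → Σ≤-*ˡ (k ∸ l) (p l) _) ⟩
    Σ≤ k (λ l → p l * Σ≤ (k ∸ l) (λ m → q m * r (k ∸ l ∸ m))) ∎
  where
  open ≡-Reasoning
  G : ℕ → ℕ → ℤ
  G l m = p l * (q m * r (k ∸ l ∸ m))
  reassociate : ∀ i l → i ≤ k → l ≤ i → (p l * q (i ∸ l)) * r (k ∸ i) ≡ G l (i ∸ l)
  reassociate i l i≤k l≤i rewrite ℕ.∸-+-assoc k l (i ∸ l) | ℕ.m+[n∸m]≡n l≤i =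
    ℤ.*-assoc (p l) _ _

⊛-identityˡ : ∀ p → (1P ⊛ p) ≈P p
⊛-identityˡ p k = trans (constP-⊛ (+ 1) p k) (ℤ.*-identityˡ (p k))

⊛-distribˡ : ∀ p q r → (p ⊛ (q ⊕ r)) ≈P ((p ⊛ q) ⊕ (p ⊛ r))
⊛-distribˡ p q r k = trans (Σ≤-cong k (λ i _ → ℤ.*-distribˡ-+ (p i) _ _)) (Σ≤-+ k _ _)

⊛-cong : ∀ {p p′ q q′} → p ≈P p′ → q ≈P q′ → (p ⊛ q) ≈P (p′ ⊛ q′)
⊛-cong p≈p′ q≈q′ k = Σ≤-cong k (λ i _ → cong₂ _*_ (p≈p′ i) (q≈q′ (k ∸ i)))

Poly-commutativeRing : CommutativeRing _ _
Poly-commutativeRing = record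
  { Carrier = Poly
  ; _≈_ = _≈P_
  ; _+_ = _⊕_
  ; _*_ = _⊛_
  ; -_ = negP
  ; 0# = 0P
  ; 1# = 1P
  ; isCommutativeRing = record
    { isRing = record
      { +-isAbelianGroup = record
        { isGroup = record
          { isMonoid = record
            { isSemigroup = record
              { isMagma = record
                { isEquivalence = record
                  { refl = λ k → refl
                  ; sym = λ p≈q k → sym (p≈q k)
                  ; trans = λ p≈q q≈r k → trans (p≈q k) (q≈r k) }
                ; ∙-cong = λ p≈p′ q≈q′ k → cong₂ _+_ (p≈p′ k) (q≈q′ k) }
              ; assoc = λ p q r k → ℤ.+-assoc (p k) (q k) (r k) }
            ; identity = (λ p k → trans (cong (_+ p k) (0P-coeff k)) (ℤ.+-identityˡ (p k)))
                       , (λ p k → trans (cong (_+_ (p k)) (0P-coeff k)) (ℤ.+-identityʳ (p k))) }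
          ; inverse = (λ p k → trans (ℤ.+-inverseˡ (p k)) (sym (0P-coeff k)))
                    , (λ p k → trans (ℤ.+-inverseʳ (p k)) (sym (0P-coeff k)))
          ; ⁻¹-cong = λ p≈q k → cong -_ (p≈q k) }
        ; comm = λ p q k → ℤ.+-comm (p k) (q k) }
      ; *-cong = ⊛-cong
      ; *-assoc = ⊛-assoc
      ; *-identity = ⊛-identityˡ , (λ p k → trans (⊛-comm p 1P k) (⊛-identityˡ p k))
      ; distrib = ⊛-distribˡ , (λ p q r k → trans (⊛-comm (q ⊕ r) p k)
                    (trans (⊛-distribˡ p q r k) (cong₂ _+_ (⊛-comm p q k) (⊛-comm p r k))))
      }
    ; *-comm = ⊛-comm
    }
  }

module ≈P-Reasoning = SetoidReasoning (CommutativeRing.setoid Poly-commutativeRing)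

≈P-refl : ∀ {p} → p ≈P p
≈P-refl k = refl

≈P-sym : ∀ {p q} → p ≈P q → q ≈P p
≈P-sym p≈q k = sym (p≈q k)

⊕-cong : ∀ {p p′ q q′} → p ≈P p′ → q ≈P q′ → (p ⊕ q) ≈P (p′ ⊕ q′)
⊕-cong p≈p′ q≈q′ k = cong₂ _+_ (p≈p′ k) (q≈q′ k)

⊕-congˡ : ∀ p {q q′} → q ≈P q′ → (p ⊕ q) ≈P (p ⊕ q′)
⊕-congˡ p = ⊕-cong (≈P-refl {p})

⊕-congʳ : ∀ q {p p′} → p ≈P p′ → (p ⊕ q) ≈P (p′ ⊕ q)
⊕-congʳ q p≈p′ = ⊕-cong p≈p′ (≈P-refl {q})

⊛-congˡ : ∀ p {q q′} → q ≈P q′ → (p ⊛ q) ≈P (p ⊛ q′)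
⊛-congˡ p = ⊛-cong (≈P-refl {p})

⊛-congʳ : ∀ q {p p′} → p ≈P p′ → (p ⊛ q) ≈P (p′ ⊛ q)
⊛-congʳ q p≈p′ = ⊛-cong p≈p′ (≈P-refl {q})

negP-cong : ∀ {p q} → p ≈P q → negP p ≈P negP q
negP-cong p≈q k = cong -_ (p≈q k)

constP-+ : ∀ a b → constP (a + b) ≈P (constP a ⊕ constP b)
constP-+ a b zero    = refl
constP-+ a b (suc k) = refl

constP-* : ∀ a b → constP (a * b) ≈P (constP a ⊛ constP b)
constP-* a b k = sym (trans (constP-⊛ a (constP b) k) (scale k))
  where
  scale : ∀ k → a * constP b k ≡ constP (a * b) k
  scale zero    = refl
  scale (suc k) = ℤ.*-zeroʳ a

constP-neg : ∀ a → constP (- a) ≈P negP (constP a)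
constP-neg a zero    = refl
constP-neg a (suc k) = refl

constP-nat+ : ∀ m n → constP (+ (m ℕ.+ n)) ≈P (constP (+ m) ⊕ constP (+ n))
constP-nat+ m n k = trans (cong (λ c → constP c k) (ℤ.pos-+ m n)) (constP-+ (+ m) (+ n) k)

constP-cong : ∀ {a b} → a ≡ b → constP a ≈P constP b
constP-cong refl = ≈P-refl

constP-homomorphism : ℤ.+-*-rawRing ACR.-Raw-AlmostCommutative⟶ ACR.fromCommutativeRing Poly-commutativeRing
constP-homomorphism = record
  { ⟦_⟧ = constP
  ; +-homo = constP-+
  ; *-homo = constP-*
  ; -‿homo = constP-neg
  ; 0-homo = ≈P-refl
  ; 1-homo = λ k → refl }

constP-≟ : ∀ a b → Maybe (constP a ≈P constP b)
constP-≟ a b with a ℤ.≟ b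
... | yes refl = just ≈P-refl
... | no _     = nothing

open Algebra.Solver.Ring ℤ.+-*-rawRing (ACR.fromCommutativeRing Poly-commutativeRing)
  constP-homomorphism constP-≟
  using (solve; _:=_; _:+_; _:*_; :-_; con)

-- Multiplication by x, the derivative and Ψ

shiftP : Poly → Poly
shiftP p zero    = + 0
shiftP p (suc k) = p k

XP : Poly
XP = shiftP 1P

shiftP-⊛ : ∀ p q → (shiftP p ⊛ q) ≈P shiftP (p ⊛ q)
shiftP-⊛ p q zero    = refl
shiftP-⊛ p q (suc k) = trans (Σ≤-shift k _) (ℤ.+-identityˡ _)

XP-⊛ : ∀ p → (XP ⊛ p) ≈P shiftP p
XP-⊛ p zero    = refl
XP-⊛ p (suc k) = trans (shiftP-⊛ 1P p (suc k)) (⊛-identityˡ p k)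

∂ : Poly → Poly
∂ p k = + suc k * p (suc k)

∂-cong : ∀ {p q} → p ≈P q → ∂ p ≈P ∂ q
∂-cong p≈q k = cong (+ suc k *_) (p≈q (suc k))

∂-⊕ : ∀ p q → ∂ (p ⊕ q) ≈P (∂ p ⊕ ∂ q)
∂-⊕ p q k = ℤ.*-distribˡ-+ (+ suc k) (p (suc k)) (q (suc k))

∂-constP : ∀ c → ∂ (constP c) ≈P 0P
∂-constP c zero    = ℤ.*-zeroʳ (+ 1)
∂-constP c (suc k) = ℤ.*-zeroʳ (+ suc (suc k))

-- Split the weight k + 1 of each product term as i + (k + 1 − i).
∂-⊛ : ∀ p q → ∂ (p ⊛ q) ≈P ((∂ p ⊛ q) ⊕ (p ⊛ ∂ q))
∂-⊛ p q k = begin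
    + suc k * Σ≤ (suc k) f
  ≡⟨ Σ≤-*ˡ (suc k) (+ suc k) f ⟨
    Σ≤ (suc k) (λ i → + suc k * f i)
  ≡⟨ Σ≤-cong (suc k) split ⟩
    Σ≤ (suc k) (λ i → + i * f i + + (suc k ∸ i) * f i)
  ≡⟨ Σ≤-+ (suc k) _ _ ⟩
    Σ≤ (suc k) (λ i → + i * f i) + Σ≤ (suc k) (λ i → + (suc k ∸ i) * f i)
  ≡⟨ cong₂ _+_ ∂-left ∂-right ⟩
    ((∂ p ⊛ q) ⊕ (p ⊛ ∂ q)) k ∎
  where
  open ≡-Reasoning
  f : ℕ → ℤ
  f i = p i * q (suc k ∸ i)
  split : ∀ i → i ≤ suc k → + suc k * f i ≡ + i * f i + + (suc k ∸ i) * f i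
  split i i≤ = begin
      + suc k * f i                          ≡⟨ cong (λ m → + m * f i) (ℕ.m+[n∸m]≡n i≤) ⟨
      + (i ℕ.+ (suc k ∸ i)) * f i            ≡⟨ ℤ.*-distribʳ-+ (f i) (+ i) (+ (suc k ∸ i)) ⟩
      + i * f i + + (suc k ∸ i) * f i        ∎
  ∂-left : Σ≤ (suc k) (λ i → + i * f i) ≡ (∂ p ⊛ q) k
  ∂-left = trans (Σ≤-shift k _) (trans (ℤ.+-identityˡ _)
             (Σ≤-cong k (λ i _ → sym (ℤ.*-assoc (+ suc i) (p (suc i)) (q (k ∸ i))))))
  move : ∀ i → i ≤ k → + (suc k ∸ i) * f i ≡ p i * (+ suc (k ∸ i) * q (suc (k ∸ i)))
  move i i≤k rewrite ℕ.+-∸-assoc 1 i≤k =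
    trans (sym (ℤ.*-assoc (+ suc (k ∸ i)) (p i) _))
      (trans (cong (_* q (suc (k ∸ i))) (ℤ.*-comm (+ suc (k ∸ i)) (p i))) (ℤ.*-assoc (p i) _ _))
  ∂-right : Σ≤ (suc k) (λ i → + (suc k ∸ i) * f i) ≡ (p ⊛ ∂ q) k
  ∂-right = trans (cong₂ _+_ (Σ≤-cong k move) (cong (λ m → + m * f (suc k)) (ℕ.n∸n≡0 k)))
              (ℤ.+-identityʳ _)

XP-⊛-∂ : ∀ q k → (XP ⊛ ∂ q) k ≡ + k * q k
XP-⊛-∂ q zero    = refl
XP-⊛-∂ q (suc k) = XP-⊛ (∂ q) (suc k)

mono : ℕ → Poly
mono p k = if p ≡ᵇ k then + 1 else + 0

XP-⊛-mono : ∀ p → (XP ⊛ mono p) ≈P mono (suc p)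
XP-⊛-mono p zero    = refl
XP-⊛-mono p (suc k) = XP-⊛ (mono p) (suc k)

mono-degree : ∀ p k → + k * mono p k ≡ + p * mono p k
mono-degree p k with p ≡ᵇ k in p≡ᵇk
... | true  = cong (λ m → + m * + 1) (sym (ℕ.≡ᵇ⇒≡ p k (subst True (sym p≡ᵇk) _)))
... | false = trans (ℤ.*-zeroʳ (+ k)) (sym (ℤ.*-zeroʳ (+ p)))

XP-⊛-∂-mono : ∀ p → (XP ⊛ ∂ (mono p)) ≈P (constP (+ p) ⊛ mono p)
XP-⊛-∂-mono p k =
  trans (XP-⊛-∂ (mono p) k) (trans (mono-degree p k) (sym (constP-⊛ (+ p) (mono p) k)))

oneMinusX≈ : oneMinusX ≈P (1P ⊕ negP XP)
oneMinusX≈ zero          = refl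
oneMinusX≈ (suc zero)    = refl
oneMinusX≈ (suc (suc k)) = refl

∂-oneMinusX : ∂ oneMinusX ≈P constP (- + 1)
∂-oneMinusX zero          = refl
∂-oneMinusX (suc zero)    = refl
∂-oneMinusX (suc (suc k)) = ℤ.*-zeroʳ (+ suc (suc (suc k)))

Ψ : ℕ → Poly → Poly
Ψ m Y = (constP (+ m) ⊛ (XP ⊛ Y)) ⊕ (constP (+ 2) ⊛ (XP ⊛ (oneMinusX ⊛ ∂ Y)))

Ψ-cong : ∀ m {p q} → p ≈P q → Ψ m p ≈P Ψ m q
Ψ-cong m p≈q = ⊕-cong (⊛-congˡ (constP (+ m)) (⊛-congˡ XP p≈q))
  (⊛-congˡ (constP (+ 2)) (⊛-congˡ XP (⊛-congˡ oneMinusX (∂-cong p≈q))))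

Ψ-⊕ : ∀ m p q → Ψ m (p ⊕ q) ≈P (Ψ m p ⊕ Ψ m q)
Ψ-⊕ m p q = begin
    Ψ m (p ⊕ q)
  ≈⟨ ⊕-congˡ (constP (+ m) ⊛ (XP ⊛ (p ⊕ q)))
       (⊛-congˡ (constP (+ 2)) (⊛-congˡ XP (⊛-congˡ oneMinusX (∂-⊕ p q)))) ⟩
    (constP (+ m) ⊛ (XP ⊛ (p ⊕ q))) ⊕ (constP (+ 2) ⊛ (XP ⊛ (oneMinusX ⊛ (∂ p ⊕ ∂ q))))
  ≈⟨ solve 7 (λ M X O P Q P′ Q′ →
         M :* (X :* (P :+ Q)) :+ con (+ 2) :* (X :* (O :* (P′ :+ Q′)))
      := (M :* (X :* P) :+ con (+ 2) :* (X :* (O :* P′)))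
           :+ (M :* (X :* Q) :+ con (+ 2) :* (X :* (O :* Q′))))
      ≈P-refl (constP (+ m)) XP oneMinusX p q (∂ p) (∂ q) ⟩
    Ψ m p ⊕ Ψ m q ∎
  where open ≈P-Reasoning

Ψ-0P : ∀ m → Ψ m 0P ≈P 0P
Ψ-0P m = begin
    Ψ m 0P
  ≈⟨ ⊕-congˡ (constP (+ m) ⊛ (XP ⊛ 0P))
       (⊛-congˡ (constP (+ 2)) (⊛-congˡ XP (⊛-congˡ oneMinusX (∂-constP (+ 0))))) ⟩
    (constP (+ m) ⊛ (XP ⊛ 0P)) ⊕ (constP (+ 2) ⊛ (XP ⊛ (oneMinusX ⊛ 0P)))
  ≈⟨ solve 3 (λ M X O → M :* (X :* con (+ 0)) :+ con (+ 2) :* (X :* (O :* con (+ 0))) := con (+ 0))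
       ≈P-refl (constP (+ m)) XP oneMinusX ⟩
    0P ∎
  where open ≈P-Reasoning

Ψ-constP : ∀ c → Ψ 0 (constP c) ≈P 0P
Ψ-constP c = begin
    Ψ 0 (constP c)
  ≈⟨ ⊕-congˡ (0P ⊛ (XP ⊛ constP c))
       (⊛-congˡ (constP (+ 2)) (⊛-congˡ XP (⊛-congˡ oneMinusX (∂-constP c)))) ⟩
    (0P ⊛ (XP ⊛ constP c)) ⊕ (constP (+ 2) ⊛ (XP ⊛ (oneMinusX ⊛ 0P)))
  ≈⟨ solve 2 (λ X O → con (+ 0) :* (X :* con c) :+ con (+ 2) :* (X :* (O :* con (+ 0))) := con (+ 0))
       ≈P-refl XP oneMinusX ⟩
    0P ∎
  where open ≈P-Reasoning

Ψ-⊛ : ∀ i j A B → Ψ (i ℕ.+ j) (A ⊛ B) ≈P ((Ψ i A ⊛ B) ⊕ (A ⊛ Ψ j B))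
Ψ-⊛ i j A B = begin
    Ψ (i ℕ.+ j) (A ⊛ B)
  ≈⟨ ⊕-cong (⊛-congʳ (XP ⊛ (A ⊛ B)) (constP-nat+ i j))
       (⊛-congˡ (constP (+ 2)) (⊛-congˡ XP (⊛-congˡ oneMinusX (∂-⊛ A B)))) ⟩
    ((constP (+ i) ⊕ constP (+ j)) ⊛ (XP ⊛ (A ⊛ B)))
      ⊕ (constP (+ 2) ⊛ (XP ⊛ (oneMinusX ⊛ ((∂ A ⊛ B) ⊕ (A ⊛ ∂ B)))))
  ≈⟨ solve 8 (λ I J X O A B A′ B′ →
         (I :+ J) :* (X :* (A :* B)) :+ con (+ 2) :* (X :* (O :* (A′ :* B :+ A :* B′)))
      := (I :* (X :* A) :+ con (+ 2) :* (X :* (O :* A′))) :* B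
           :+ A :* (J :* (X :* B) :+ con (+ 2) :* (X :* (O :* B′))))
      ≈P-refl (constP (+ i)) (constP (+ j)) XP oneMinusX A B (∂ A) (∂ B) ⟩
    (Ψ i A ⊛ B) ⊕ (A ⊛ Ψ j B) ∎
  where open ≈P-Reasoning

Ψ-constP-⊛ : ∀ m c Y → Ψ m (constP c ⊛ Y) ≈P (constP c ⊛ Ψ m Y)
Ψ-constP-⊛ m c Y = begin
    Ψ m (constP c ⊛ Y)
  ≈⟨ Ψ-⊛ 0 m (constP c) Y ⟩
    (Ψ 0 (constP c) ⊛ Y) ⊕ (constP c ⊛ Ψ m Y)
  ≈⟨ ⊕-congʳ (constP c ⊛ Ψ m Y) (⊛-congʳ Y (Ψ-constP c)) ⟩
    (0P ⊛ Y) ⊕ (constP c ⊛ Ψ m Y)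
  ≈⟨ solve 2 (λ Y Z → con (+ 0) :* Y :+ Z := Z) ≈P-refl Y (constP c ⊛ Ψ m Y) ⟩
    constP c ⊛ Ψ m Y ∎
  where open ≈P-Reasoning

-- The signed powers (−1)ʲ (1 − x)^⌊j/2⌋

signedPower : ℕ → Poly
signedPower 0             = 1P
signedPower 1             = constP (- + 1)
signedPower (suc (suc j)) = oneMinusX ⊛ signedPower j

parity : ℕ → ℕ
parity 0             = 0
parity 1             = 1
parity (suc (suc j)) = parity j

halves+parity : ∀ j → ⌊ j /2⌋ ℕ.+ ⌊ j /2⌋ ℕ.+ parity j ≡ j
halves+parity 0             = refl
halves+parity 1             = refl
halves+parity (suc (suc j)) =
  cong suc (trans (cong (ℕ._+ parity j) (ℕ.+-suc ⌊ j /2⌋ ⌊ j /2⌋)) (cong suc (halves+parity j)))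

⌊/2⌋≡/2 : ∀ j → ⌊ j /2⌋ ≡ j / 2
⌊/2⌋≡/2 0             = refl
⌊/2⌋≡/2 1             = refl
⌊/2⌋≡/2 (suc (suc j)) =
  trans (cong suc (⌊/2⌋≡/2 j)) (sym (ℕ.m/n≡1+[m∸n]/n {suc (suc j)} {2} (s≤s (s≤s z≤n))))

signedPower≈ : ∀ j → signedPower j ≈P (constP (sgn j) ⊛ (oneMinusX ^P ⌊ j /2⌋))
signedPower≈ 0 = solve 0 (con (+ 1) := con (+ 1) :* con (+ 1)) ≈P-refl
signedPower≈ 1 = solve 0 (con (- + 1) := con (- + 1) :* con (+ 1)) ≈P-refl
signedPower≈ (suc (suc j)) = begin
    oneMinusX ⊛ signedPower j
  ≈⟨ ⊛-congˡ oneMinusX (signedPower≈ j) ⟩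
    oneMinusX ⊛ (constP (sgn j) ⊛ P)
  ≈⟨ solve 3 (λ O S P → O :* (S :* P) := S :* (O :* P)) ≈P-refl oneMinusX (constP (sgn j)) P ⟩
    constP (sgn j) ⊛ (oneMinusX ⊛ P)
  ≈⟨ ⊛-congʳ (oneMinusX ⊛ P) (constP-cong (ℤ.neg-involutive (sgn j))) ⟨
    constP (- - sgn j) ⊛ (oneMinusX ⊛ P) ∎
  where
  open ≈P-Reasoning
  P = oneMinusX ^P ⌊ j /2⌋

signedPower-suc-parity : ∀ j →
  signedPower (suc j) ≈P (negP (signedPower j) ⊕ (constP (+ parity j) ⊛ (XP ⊛ signedPower j)))
signedPower-suc-parity 0 =
  solve 1 (λ X → con (- + 1) := :- con (+ 1) :+ con (+ 0) :* (X :* con (+ 1))) ≈P-refl XP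
signedPower-suc-parity 1 = begin
    oneMinusX ⊛ 1P
  ≈⟨ ⊛-congʳ 1P oneMinusX≈ ⟩
    (1P ⊕ negP XP) ⊛ 1P
  ≈⟨ solve 1 (λ X → (con (+ 1) :+ :- X) :* con (+ 1)
               := :- con (- + 1) :+ con (+ 1) :* (X :* con (- + 1))) ≈P-refl XP ⟩
    negP (constP (- + 1)) ⊕ (1P ⊛ (XP ⊛ constP (- + 1))) ∎
  where open ≈P-Reasoning
signedPower-suc-parity (suc (suc j)) = begin
    oneMinusX ⊛ signedPower (suc j)
  ≈⟨ ⊛-congˡ oneMinusX (signedPower-suc-parity j) ⟩
    oneMinusX ⊛ (negP A ⊕ (constP (+ parity j) ⊛ (XP ⊛ A)))
  ≈⟨ solve 4 (λ O A E X → O :* (:- A :+ E :* (X :* A)) := :- (O :* A) :+ E :* (X :* (O :* A)))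
       ≈P-refl oneMinusX A (constP (+ parity j)) XP ⟩
    negP (oneMinusX ⊛ A) ⊕ (constP (+ parity j) ⊛ (XP ⊛ (oneMinusX ⊛ A))) ∎
  where
  open ≈P-Reasoning
  A = signedPower j

oneMinusX-⊛-∂-signedPower : ∀ j →
  (oneMinusX ⊛ ∂ (signedPower j)) ≈P negP (constP (+ ⌊ j /2⌋) ⊛ signedPower j)
oneMinusX-⊛-∂-signedPower 0 = begin
    oneMinusX ⊛ ∂ 1P
  ≈⟨ ⊛-congˡ oneMinusX (∂-constP (+ 1)) ⟩
    oneMinusX ⊛ 0P
  ≈⟨ solve 1 (λ O → O :* con (+ 0) := :- (con (+ 0) :* con (+ 1))) ≈P-refl oneMinusX ⟩
    negP (0P ⊛ 1P) ∎
  where open ≈P-Reasoning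
oneMinusX-⊛-∂-signedPower 1 = begin
    oneMinusX ⊛ ∂ (constP (- + 1))
  ≈⟨ ⊛-congˡ oneMinusX (∂-constP (- + 1)) ⟩
    oneMinusX ⊛ 0P
  ≈⟨ solve 1 (λ O → O :* con (+ 0) := :- (con (+ 0) :* con (- + 1))) ≈P-refl oneMinusX ⟩
    negP (0P ⊛ constP (- + 1)) ∎
  where open ≈P-Reasoning
oneMinusX-⊛-∂-signedPower (suc (suc j)) = begin
    oneMinusX ⊛ ∂ (oneMinusX ⊛ A)
  ≈⟨ ⊛-congˡ oneMinusX (∂-⊛ oneMinusX A) ⟩
    oneMinusX ⊛ ((∂ oneMinusX ⊛ A) ⊕ (oneMinusX ⊛ ∂ A))
  ≈⟨ ⊛-congˡ oneMinusX (⊕-cong (⊛-congʳ A ∂-oneMinusX) (oneMinusX-⊛-∂-signedPower j)) ⟩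
    oneMinusX ⊛ ((constP (- + 1) ⊛ A) ⊕ negP (H ⊛ A))
  ≈⟨ solve 3 (λ O A H → O :* (con (- + 1) :* A :+ :- (H :* A)) := :- ((con (+ 1) :+ H) :* (O :* A)))
       ≈P-refl oneMinusX A H ⟩
    negP ((1P ⊕ H) ⊛ (oneMinusX ⊛ A))
  ≈⟨ negP-cong (⊛-congʳ (oneMinusX ⊛ A) (constP-nat+ 1 ⌊ j /2⌋)) ⟨
    negP (constP (+ suc ⌊ j /2⌋) ⊛ (oneMinusX ⊛ A)) ∎
  where
  open ≈P-Reasoning
  A = signedPower j
  H = constP (+ ⌊ j /2⌋)

signedPower-suc : ∀ j → signedPower (suc j) ≈P (negP (signedPower j) ⊕ Ψ j (signedPower j))
signedPower-suc j = begin
    signedPower (suc j)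
  ≈⟨ signedPower-suc-parity j ⟩
    negP A ⊕ (E ⊛ (XP ⊛ A))
  ≈⟨ solve 4 (λ A E H X → :- A :+ E :* (X :* A)
                         := :- A :+ (((H :+ H) :+ E) :* (X :* A) :+ con (+ 2) :* (X :* (:- (H :* A)))))
       ≈P-refl A E H XP ⟩
    negP A ⊕ ((((H ⊕ H) ⊕ E) ⊛ (XP ⊛ A)) ⊕ (constP (+ 2) ⊛ (XP ⊛ negP (H ⊛ A))))
  ≈⟨ ⊕-congˡ (negP A) (⊕-cong (⊛-congʳ (XP ⊛ A) constP-j)
       (⊛-congˡ (constP (+ 2)) (⊛-congˡ XP (≈P-sym (oneMinusX-⊛-∂-signedPower j))))) ⟩
    negP A ⊕ Ψ j A ∎
  where
  open ≈P-Reasoning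
  A = signedPower j
  E = constP (+ parity j)
  H = constP (+ ⌊ j /2⌋)
  constP-j : ((H ⊕ H) ⊕ E) ≈P constP (+ j)
  constP-j = begin
      (H ⊕ H) ⊕ E
    ≈⟨ ⊕-congʳ E (constP-nat+ ⌊ j /2⌋ ⌊ j /2⌋) ⟨
      constP (+ (⌊ j /2⌋ ℕ.+ ⌊ j /2⌋)) ⊕ E
    ≈⟨ constP-nat+ (⌊ j /2⌋ ℕ.+ ⌊ j /2⌋) (parity j) ⟨
      constP (+ (⌊ j /2⌋ ℕ.+ ⌊ j /2⌋ ℕ.+ parity j))
    ≈⟨ constP-cong (cong +_ (halves+parity j)) ⟩
      constP (+ j) ∎

-- Sequences with T_{m+1} = T_m + Ψ_m T_m

ΣP : ℕ → (ℕ → Poly) → Poly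
ΣP zero    f = f 0
ΣP (suc m) f = ΣP m f ⊕ f (suc m)

ΣP-cong : ∀ m {f g} → (∀ j → j ≤ m → f j ≈P g j) → ΣP m f ≈P ΣP m g
ΣP-cong zero    f≈g = f≈g 0 z≤n
ΣP-cong (suc m) f≈g = ⊕-cong (ΣP-cong m (λ j j≤m → f≈g j (ℕ.m≤n⇒m≤1+n j≤m))) (f≈g (suc m) ℕ.≤-refl)

ΣP-⊕ : ∀ m f g → ΣP m (λ j → f j ⊕ g j) ≈P (ΣP m f ⊕ ΣP m g)
ΣP-⊕ zero    f g = ≈P-refl
ΣP-⊕ (suc m) f g k =
  trans (cong (_+ (f (suc m) k + g (suc m) k)) (ΣP-⊕ m f g k))
    (interchange (ΣP m f k) (ΣP m g k) (f (suc m) k) (g (suc m) k))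

ΣP-negP : ∀ m f → ΣP m (λ j → negP (f j)) ≈P negP (ΣP m f)
ΣP-negP zero    f = ≈P-refl
ΣP-negP (suc m) f k =
  trans (cong (_+ - f (suc m) k) (ΣP-negP m f k)) (sym (ℤ.neg-distrib-+ (ΣP m f k) (f (suc m) k)))

ΣP-shift : ∀ m f → ΣP (suc m) f ≈P (f 0 ⊕ ΣP m (f ∘ suc))
ΣP-shift zero    f = ≈P-refl
ΣP-shift (suc m) f k =
  trans (cong (_+ f (suc (suc m)) k) (ΣP-shift m f k)) (ℤ.+-assoc (f 0 k) _ _)

Σ1to≈ΣP : ∀ m g → Σ1to (suc m) g ≈P ΣP m (g ∘ suc)
Σ1to≈ΣP zero    g k = ℤ.+-identityˡ (g 1 k)
Σ1to≈ΣP (suc m) g = ⊕-congʳ (g (suc (suc m))) (Σ1to≈ΣP m g)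

Ψ-ΣP : ∀ n m f → Ψ n (ΣP m f) ≈P ΣP m (Ψ n ∘ f)
Ψ-ΣP n zero    f = ≈P-refl
Ψ-ΣP n (suc m) f = begin
    Ψ n (ΣP m f ⊕ f (suc m))            ≈⟨ Ψ-⊕ n (ΣP m f) (f (suc m)) ⟩
    Ψ n (ΣP m f) ⊕ Ψ n (f (suc m))      ≈⟨ ⊕-congʳ (Ψ n (f (suc m))) (Ψ-ΣP n m f) ⟩
    ΣP m (Ψ n ∘ f) ⊕ Ψ n (f (suc m))    ∎
  where open ≈P-Reasoning

module BinomialInversion
  (Tp : ℕ → Poly)
  (Tp-zero : Tp 0 ≈P 1P)
  (Tp-suc : ∀ m → Tp (suc m) ≈P (Tp m ⊕ Ψ m (Tp m)))
  where

  signedPower-⊛-Tp : ∀ j m →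
    ((signedPower j ⊛ Tp (suc m)) ⊕ (signedPower (suc j) ⊛ Tp m)) ≈P Ψ (j ℕ.+ m) (signedPower j ⊛ Tp m)
  signedPower-⊛-Tp j m = begin
      (A ⊛ Tp (suc m)) ⊕ (signedPower (suc j) ⊛ Tm)
    ≈⟨ ⊕-cong (⊛-congˡ A (Tp-suc m)) (⊛-congʳ Tm (signedPower-suc j)) ⟩
      (A ⊛ (Tm ⊕ Ψ m Tm)) ⊕ ((negP A ⊕ Ψ j A) ⊛ Tm)
    ≈⟨ solve 4 (λ A T ΨT ΨA → A :* (T :+ ΨT) :+ (:- A :+ ΨA) :* T := ΨA :* T :+ A :* ΨT)
         ≈P-refl A Tm (Ψ m Tm) (Ψ j A) ⟩
      (Ψ j A ⊛ Tm) ⊕ (A ⊛ Ψ m Tm)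
    ≈⟨ Ψ-⊛ j m A Tm ⟨
      Ψ (j ℕ.+ m) (A ⊛ Tm) ∎
    where
    open ≈P-Reasoning
    A = signedPower j
    Tm = Tp m

  binomialTerm : ℕ → ℕ → Poly
  binomialTerm n j = constP (+ (n C j)) ⊛ (signedPower j ⊛ Tp (n ∸ j))

  binomialSum : ℕ → Poly
  binomialSum n = ΣP n (binomialTerm n)

  liftT liftA : ℕ → ℕ → Poly
  liftT n j = constP (+ (n C j)) ⊛ (signedPower j ⊛ Tp (suc n ∸ j))
  liftA n j = constP (+ (n C j)) ⊛ (signedPower (suc j) ⊛ Tp (n ∸ j))

  -- Pascal's rule, dropping the top term n C (n + 1) = 0.
  binomialSum-suc-split : ∀ n → binomialSum (suc n) ≈P (ΣP n (liftT n) ⊕ ΣP n (liftA n))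
  binomialSum-suc-split n = begin
      ΣP (suc n) (binomialTerm (suc n))
    ≈⟨ ΣP-shift n (binomialTerm (suc n)) ⟩
      binomialTerm (suc n) 0 ⊕ ΣP n (binomialTerm (suc n) ∘ suc)
    ≈⟨ ⊕-congˡ (binomialTerm (suc n) 0) (ΣP-cong n (λ j _ → pascal j)) ⟩
      H 0 ⊕ ΣP n (λ j → F j ⊕ H (suc j))
    ≈⟨ ⊕-congˡ (H 0) (ΣP-⊕ n F (H ∘ suc)) ⟩
      H 0 ⊕ (ΣP n F ⊕ ΣP n (H ∘ suc))
    ≈⟨ solve 3 (λ a b c → a :+ (b :+ c) := (a :+ c) :+ b) ≈P-refl (H 0) (ΣP n F) (ΣP n (H ∘ suc)) ⟩
      (H 0 ⊕ ΣP n (H ∘ suc)) ⊕ ΣP n F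
    ≈⟨ ⊕-congʳ (ΣP n F) (ΣP-shift n H) ⟨
      ΣP (suc n) H ⊕ ΣP n F
    ≈⟨ ⊕-congʳ (ΣP n F) (⊕-congˡ (ΣP n H) (⊛-congʳ Z₀ (constP-cong (cong +_ (k>n⇒nCk≡0 (ℕ.n<1+n n)))))) ⟩
      (ΣP n H ⊕ (0P ⊛ Z₀)) ⊕ ΣP n F
    ≈⟨ solve 3 (λ a b c → (a :+ con (+ 0) :* b) :+ c := a :+ c) ≈P-refl (ΣP n H) Z₀ (ΣP n F) ⟩
      ΣP n H ⊕ ΣP n F ∎
    where
    open ≈P-Reasoning
    H = liftT n
    F = liftA n
    Z₀ = signedPower (suc n) ⊛ Tp (n ∸ n)
    pascal : ∀ j → binomialTerm (suc n) (suc j) ≈P (F j ⊕ H (suc j))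
    pascal j = begin
        constP (+ (suc n C suc j)) ⊛ Z
      ≈⟨ ⊛-congʳ Z (constP-cong (cong +_ (nCk+nC[k+1]≡[n+1]C[k+1] n j))) ⟨
        constP (+ (n C j ℕ.+ n C suc j)) ⊛ Z
      ≈⟨ ⊛-congʳ Z (constP-nat+ (n C j) (n C suc j)) ⟩
        (constP (+ (n C j)) ⊕ constP (+ (n C suc j))) ⊛ Z
      ≈⟨ solve 3 (λ a b z → (a :+ b) :* z := a :* z :+ b :* z) ≈P-refl
           (constP (+ (n C j))) (constP (+ (n C suc j))) Z ⟩
        F j ⊕ H (suc j) ∎
      where Z = signedPower (suc j) ⊛ Tp (n ∸ j)

  liftT⊕liftA : ∀ n j → j ≤ n → (liftT n j ⊕ liftA n j) ≈P Ψ n (binomialTerm n j)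
  liftT⊕liftA n j j≤n rewrite ℕ.+-∸-assoc 1 j≤n = begin
      (c ⊛ (A ⊛ Tp (suc m))) ⊕ (c ⊛ (signedPower (suc j) ⊛ Tp m))
    ≈⟨ ⊛-distribˡ c (A ⊛ Tp (suc m)) (signedPower (suc j) ⊛ Tp m) ⟨
      c ⊛ ((A ⊛ Tp (suc m)) ⊕ (signedPower (suc j) ⊛ Tp m))
    ≈⟨ ⊛-congˡ c (signedPower-⊛-Tp j m) ⟩
      c ⊛ Ψ (j ℕ.+ m) (A ⊛ Tp m)
    ≈⟨ Ψ-constP-⊛ (j ℕ.+ m) (+ (n C j)) (A ⊛ Tp m) ⟨
      Ψ (j ℕ.+ m) (c ⊛ (A ⊛ Tp m))
    ≡⟨ cong (λ n′ → Ψ n′ (c ⊛ (A ⊛ Tp m))) (ℕ.m+[n∸m]≡n j≤n) ⟩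
      Ψ n (binomialTerm n j) ∎
    where
    open ≈P-Reasoning
    c = constP (+ (n C j))
    A = signedPower j
    m = n ∸ j

  binomialSum-suc : ∀ n → binomialSum (suc n) ≈P Ψ n (binomialSum n)
  binomialSum-suc n = begin
      binomialSum (suc n)                        ≈⟨ binomialSum-suc-split n ⟩
      ΣP n (liftT n) ⊕ ΣP n (liftA n)            ≈⟨ ΣP-⊕ n (liftT n) (liftA n) ⟨
      ΣP n (λ j → liftT n j ⊕ liftA n j)         ≈⟨ ΣP-cong n (liftT⊕liftA n) ⟩
      ΣP n (Ψ n ∘ binomialTerm n)                ≈⟨ Ψ-ΣP n n (binomialTerm n) ⟨
      Ψ n (binomialSum n)                        ∎
    where open ≈P-Reasoning

  binomialSum-0 : binomialSum 0 ≈P 1P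
  binomialSum-0 = begin
      1P ⊛ (1P ⊛ Tp 0)       ≈⟨ ⊛-congˡ 1P (⊛-congˡ 1P Tp-zero) ⟩
      1P ⊛ (1P ⊛ 1P)         ≈⟨ solve 0 (con (+ 1) :* (con (+ 1) :* con (+ 1)) := con (+ 1)) ≈P-refl ⟩
      1P                     ∎
    where open ≈P-Reasoning

  binomialSum-vanishes : ∀ n → binomialSum (suc n) ≈P 0P
  binomialSum-vanishes zero = begin
      binomialSum 1             ≈⟨ binomialSum-suc 0 ⟩
      Ψ 0 (binomialSum 0)       ≈⟨ Ψ-cong 0 binomialSum-0 ⟩
      Ψ 0 1P                    ≈⟨ Ψ-constP (+ 1) ⟩
      0P                        ∎
    where open ≈P-Reasoning
  binomialSum-vanishes (suc n) = begin
      binomialSum (suc (suc n))     ≈⟨ binomialSum-suc (suc n) ⟩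
      Ψ (suc n) (binomialSum (suc n)) ≈⟨ Ψ-cong (suc n) (binomialSum-vanishes n) ⟩
      Ψ (suc n) 0P                  ≈⟨ Ψ-0P (suc n) ⟩
      0P                            ∎
    where open ≈P-Reasoning

  summand : ℕ → ℕ → Poly
  summand n j = (+ (n C j) * sgn (j ∸ 1)) · ((oneMinusX ^P (j / 2)) ⊛ Tp (n ∸ j))

  summand≈-binomialTerm : ∀ n j → summand n (suc j) ≈P negP (binomialTerm n (suc j))
  summand≈-binomialTerm n j = begin
      (+ (n C suc j) * sgn j) · (P ⊛ T′)
    ≈⟨ constP-⊛ (+ (n C suc j) * sgn j) (P ⊛ T′) ⟨
      constP (+ (n C suc j) * sgn j) ⊛ (P ⊛ T′)
    ≈⟨ ⊛-congʳ (P ⊛ T′) (constP-* (+ (n C suc j)) (sgn j)) ⟩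
      (c ⊛ constP (sgn j)) ⊛ (P ⊛ T′)
    ≈⟨ solve 4 (λ c s p t → (c :* s) :* (p :* t) := :- (c :* (((:- s) :* p) :* t)))
         ≈P-refl c (constP (sgn j)) P T′ ⟩
      negP (c ⊛ ((negP (constP (sgn j)) ⊛ P) ⊛ T′))
    ≈⟨ negP-cong (⊛-congˡ c (⊛-congʳ T′ (⊛-congʳ P (constP-neg (sgn j))))) ⟨
      negP (c ⊛ ((constP (sgn (suc j)) ⊛ P) ⊛ T′))
    ≡⟨ cong (λ e → negP (c ⊛ ((constP (sgn (suc j)) ⊛ (oneMinusX ^P e)) ⊛ T′))) (⌊/2⌋≡/2 (suc j)) ⟨
      negP (c ⊛ ((constP (sgn (suc j)) ⊛ (oneMinusX ^P ⌊ suc j /2⌋)) ⊛ T′))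
    ≈⟨ negP-cong (⊛-congˡ c (⊛-congʳ T′ (signedPower≈ (suc j)))) ⟨
      negP (binomialTerm n (suc j)) ∎
    where
    open ≈P-Reasoning
    c = constP (+ (n C suc j))
    P = oneMinusX ^P (suc j / 2)
    T′ = Tp (n ∸ suc j)

  binomial-identity : ∀ n → n ≥ 1 → ∀ k →
    Tp n k ≡ Σ1to n (λ j → (+ (n C j) * sgn (j ∸ 1)) · ((oneMinusX ^P (j / 2)) ⊛ Tp (n ∸ j))) k
  binomial-identity (suc n) _ = begin
      Tp (suc n)
    ≈⟨ solve 2 (λ t b → t := (con (+ 1) :* (con (+ 1) :* t) :+ b) :+ :- b) ≈P-refl (Tp (suc n)) B ⟩
      (binomialTerm (suc n) 0 ⊕ B) ⊕ negP B
    ≈⟨ ⊕-congʳ (negP B) (ΣP-shift n (binomialTerm (suc n))) ⟨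
      binomialSum (suc n) ⊕ negP B
    ≈⟨ ⊕-congʳ (negP B) (binomialSum-vanishes n) ⟩
      0P ⊕ negP B
    ≈⟨ solve 1 (λ b → con (+ 0) :+ :- b := :- b) ≈P-refl B ⟩
      negP B
    ≈⟨ ΣP-negP n (binomialTerm (suc n) ∘ suc) ⟨
      ΣP n (negP ∘ binomialTerm (suc n) ∘ suc)
    ≈⟨ ΣP-cong n (λ j _ → summand≈-binomialTerm (suc n) j) ⟨
      ΣP n (summand (suc n) ∘ suc)
    ≈⟨ Σ1to≈ΣP n (summand (suc n)) ⟨
      Σ1to (suc n) (summand (suc n)) ∎
    where
    open ≈P-Reasoning
    B = ΣP n (binomialTerm (suc n) ∘ suc)

-- Peaks after inserting a new maximum

genPoly : List ℕ → Poly
genPoly []       = 0P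
genPoly (x ∷ xs) = mono x ⊕ genPoly xs

genPoly-coeff : ∀ (f : List ℕ → ℕ) L k →
  + length (filterᵇ (λ π → f π ≡ᵇ k) L) ≡ genPoly (map f L) k
genPoly-coeff f []      k = sym (0P-coeff k)
genPoly-coeff f (x ∷ L) k with f x ≡ᵇ k
... | true  = cong (_+_ (+ 1)) (genPoly-coeff f L k)
... | false = trans (genPoly-coeff f L k) (sym (ℤ.+-identityˡ (genPoly (map f L) k)))

genPoly-++ : ∀ xs ys → genPoly (xs ++ ys) ≈P (genPoly xs ⊕ genPoly ys)
genPoly-++ []       ys k = sym (trans (cong (_+ genPoly ys k) (0P-coeff k)) (ℤ.+-identityˡ _))
genPoly-++ (x ∷ xs) ys k =
  trans (cong (_+_ (mono x k)) (genPoly-++ xs ys k)) (sym (ℤ.+-assoc (mono x k) (genPoly xs k) _))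

genPoly-↭ : ∀ {xs ys} → xs ↭ ys → genPoly xs ≈P genPoly ys
genPoly-↭ ↭.refl                       = ≈P-refl
genPoly-↭ (↭.prep x xs↭ys)             = ⊕-congˡ (mono x) (genPoly-↭ xs↭ys)
genPoly-↭ (↭.swap {xs} {ys} x y xs↭ys) = begin
    mono x ⊕ (mono y ⊕ genPoly xs)    ≈⟨ ⊕-congˡ (mono x) (⊕-congˡ (mono y) (genPoly-↭ xs↭ys)) ⟩
    mono x ⊕ (mono y ⊕ genPoly ys)    ≈⟨ solve 3 (λ a b c → a :+ (b :+ c) := b :+ (a :+ c)) ≈P-refl
                                           (mono x) (mono y) (genPoly ys) ⟩
    mono y ⊕ (mono x ⊕ genPoly ys)    ∎
  where open ≈P-Reasoning
genPoly-↭ (↭.trans xs↭ys ys↭zs) k = trans (genPoly-↭ xs↭ys k) (genPoly-↭ ys↭zs k)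

genPoly-map-suc : ∀ L → genPoly (map suc L) ≈P (XP ⊛ genPoly L)
genPoly-map-suc []      = solve 1 (λ X → con (+ 0) := X :* con (+ 0)) ≈P-refl XP
genPoly-map-suc (x ∷ L) = begin
    mono (suc x) ⊕ genPoly (map suc L)       ≈⟨ ⊕-cong (≈P-sym (XP-⊛-mono x)) (genPoly-map-suc L) ⟩
    (XP ⊛ mono x) ⊕ (XP ⊛ genPoly L)         ≈⟨ ⊛-distribˡ XP (mono x) (genPoly L) ⟨
    XP ⊛ (mono x ⊕ genPoly L)                ∎
  where open ≈P-Reasoning

inserts : ℕ → List ℕ → List (List ℕ)
inserts M []      = (M ∷ []) ∷ []
inserts M (a ∷ w) = (M ∷ a ∷ w) ∷ map (a ∷_) (inserts M w)

insertionPoly : ℕ → ℕ → Poly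
insertionPoly p n = ((1P ⊕ (constP (+ 2) ⊛ constP (+ p))) ⊛ mono p)
                  ⊕ ((constP (+ n) ⊕ negP (constP (+ 2) ⊛ constP (+ p))) ⊛ (XP ⊛ mono p))

insertionPoly≈ : ∀ p n → insertionPoly p n ≈P (mono p ⊕ Ψ n (mono p))
insertionPoly≈ p n = begin
    insertionPoly p n
  ≈⟨ solve 4 (λ X Y P N →
          (con (+ 1) :+ con (+ 2) :* P) :* Y :+ (N :+ :- (con (+ 2) :* P)) :* (X :* Y)
       := Y :+ (N :* (X :* Y) :+ con (+ 2) :* ((con (+ 1) :+ :- X) :* (P :* Y))))
       ≈P-refl XP (mono p) (constP (+ p)) (constP (+ n)) ⟩
    mono p ⊕ ((constP (+ n) ⊛ (XP ⊛ mono p)) ⊕ (constP (+ 2) ⊛ ((1P ⊕ negP XP) ⊛ (constP (+ p) ⊛ mono p))))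
  ≈⟨ ⊕-congˡ (mono p) (⊕-congˡ (constP (+ n) ⊛ (XP ⊛ mono p))
       (⊛-congˡ (constP (+ 2)) (⊛-cong (≈P-sym oneMinusX≈) (≈P-sym (XP-⊛-∂-mono p))))) ⟩
    mono p ⊕ ((constP (+ n) ⊛ (XP ⊛ mono p)) ⊕ (constP (+ 2) ⊛ (oneMinusX ⊛ (XP ⊛ ∂ (mono p)))))
  ≈⟨ ⊕-congˡ (mono p) (⊕-congˡ (constP (+ n) ⊛ (XP ⊛ mono p))
       (⊛-congˡ (constP (+ 2)) (solve 3 (λ O X D → O :* (X :* D) := X :* (O :* D)) ≈P-refl
         oneMinusX XP (∂ (mono p))))) ⟩
    mono p ⊕ Ψ n (mono p) ∎
  where open ≈P-Reasoning

insertionPoly-step : ∀ α q m e L → α ≡ 0 ⊎ (α ≡ 1 × e ≡ suc q) →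
  (mono e ⊕ genPoly L) ≈P insertionPoly q m →
  (mono (suc q) ⊕ (mono e ⊕ genPoly (map (α ℕ.+_) L))) ≈P insertionPoly (α ℕ.+ q) (suc m)
insertionPoly-step .0 q m e L (inj₁ refl) IH = begin
    mono (suc q) ⊕ (mono e ⊕ genPoly (map (0 ℕ.+_) L))
  ≡⟨ cong (λ L′ → mono (suc q) ⊕ (mono e ⊕ genPoly L′)) (List.map-id L) ⟩
    mono (suc q) ⊕ (mono e ⊕ genPoly L)
  ≈⟨ ⊕-cong (≈P-sym (XP-⊛-mono q)) IH ⟩
    (XP ⊛ Y) ⊕ insertionPoly q m
  ≈⟨ solve 4 (λ X Y Q M →
          X :* Y :+ ((con (+ 1) :+ con (+ 2) :* Q) :* Y :+ (M :+ :- (con (+ 2) :* Q)) :* (X :* Y))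
       := (con (+ 1) :+ con (+ 2) :* Q) :* Y :+ ((con (+ 1) :+ M) :+ :- (con (+ 2) :* Q)) :* (X :* Y))
       ≈P-refl XP Y (constP (+ q)) (constP (+ m)) ⟩
    ((1P ⊕ (constP (+ 2) ⊛ constP (+ q))) ⊛ Y)
      ⊕ (((1P ⊕ constP (+ m)) ⊕ negP (constP (+ 2) ⊛ constP (+ q))) ⊛ (XP ⊛ Y))
  ≈⟨ ⊕-congˡ ((1P ⊕ (constP (+ 2) ⊛ constP (+ q))) ⊛ Y)
       (⊛-congʳ (XP ⊛ Y) (⊕-congʳ (negP (constP (+ 2) ⊛ constP (+ q))) (constP-nat+ 1 m))) ⟨
    insertionPoly q (suc m) ∎
  where
  open ≈P-Reasoning
  Y = mono q
insertionPoly-step .1 q m .(suc q) L (inj₂ (refl , refl)) IH = begin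
    mono (suc q) ⊕ (mono (suc q) ⊕ genPoly (map suc L))
  ≈⟨ ⊕-cong (≈P-sym (XP-⊛-mono q)) (⊕-cong (≈P-sym (XP-⊛-mono q)) (genPoly-map-suc L)) ⟩
    (XP ⊛ Y) ⊕ ((XP ⊛ Y) ⊕ (XP ⊛ genPoly L))
  ≈⟨ ⊕-congˡ (XP ⊛ Y) (⊕-congˡ (XP ⊛ Y) (⊛-congˡ XP genPoly-L)) ⟩
    (XP ⊛ Y) ⊕ ((XP ⊛ Y) ⊕ (XP ⊛ (insertionPoly q m ⊕ negP (XP ⊛ Y))))
  ≈⟨ solve 4 (λ X Y Q M →
          X :* Y :+ (X :* Y :+ X :* (((con (+ 1) :+ con (+ 2) :* Q) :* Y
                                    :+ (M :+ :- (con (+ 2) :* Q)) :* (X :* Y)) :+ :- (X :* Y)))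
       := (con (+ 1) :+ con (+ 2) :* (con (+ 1) :+ Q)) :* (X :* Y)
            :+ ((con (+ 1) :+ M) :+ :- (con (+ 2) :* (con (+ 1) :+ Q))) :* (X :* (X :* Y)))
       ≈P-refl XP Y (constP (+ q)) (constP (+ m)) ⟩
    ((1P ⊕ (constP (+ 2) ⊛ (1P ⊕ constP (+ q)))) ⊛ (XP ⊛ Y))
      ⊕ (((1P ⊕ constP (+ m)) ⊕ negP (constP (+ 2) ⊛ (1P ⊕ constP (+ q)))) ⊛ (XP ⊛ (XP ⊛ Y)))
  ≈⟨ ⊕-cong (⊛-cong (⊕-congˡ 1P (⊛-congˡ (constP (+ 2)) Q+1)) (XP-⊛-mono q))
       (⊛-cong (⊕-cong (≈P-sym (constP-nat+ 1 m)) (negP-cong (⊛-congˡ (constP (+ 2)) Q+1)))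
               (⊛-congˡ XP (XP-⊛-mono q))) ⟩
    insertionPoly (suc q) (suc m) ∎
  where
  open ≈P-Reasoning
  Y = mono q
  Q+1 : (1P ⊕ constP (+ q)) ≈P constP (+ suc q)
  Q+1 = ≈P-sym (constP-nat+ 1 q)
  genPoly-L : genPoly L ≈P (insertionPoly q m ⊕ negP (XP ⊛ Y))
  genPoly-L = begin
      genPoly L
    ≈⟨ solve 2 (λ A B → B := (A :+ B) :+ :- A) ≈P-refl (XP ⊛ Y) (genPoly L) ⟩
      ((XP ⊛ Y) ⊕ genPoly L) ⊕ negP (XP ⊛ Y)
    ≈⟨ ⊕-congʳ (negP (XP ⊛ Y)) (⊕-congʳ (genPoly L) (XP-⊛-mono q)) ⟩
      (mono (suc q) ⊕ genPoly L) ⊕ negP (XP ⊛ Y)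
    ≈⟨ ⊕-congʳ (negP (XP ⊛ Y)) IH ⟩
      insertionPoly q m ⊕ negP (XP ⊛ Y) ∎

<⇒<ᵇ≡true : ∀ {m n} → m < n → (m <ᵇ n) ≡ true
<⇒<ᵇ≡true m<n = Equivalence.to Bool.T-≡ (ℕ.<⇒<ᵇ m<n)

≤⇒<ᵇ≡false : ∀ {m n} → n ≤ m → (m <ᵇ n) ≡ false
≤⇒<ᵇ≡false {m} {n} n≤m with m <ᵇ n in m<ᵇn
... | false = refl
... | true  = ⊥-elim (ℕ.≤⇒≯ n≤m (ℕ.<ᵇ⇒< m n (subst True (sym m<ᵇn) _)))

peak : ℕ → ℕ → ℕ → ℕ
peak a b c = if (a <ᵇ b) ∧ (c <ᵇ b) then 1 else 0

peak-below : ∀ x y {M} → y < M → peak x y M ≡ 0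
peak-below x y y<M rewrite ≤⇒<ᵇ≡false (ℕ.<⇒≤ y<M) | Bool.∧-zeroʳ (x <ᵇ y) = refl

peak-top : ∀ {x y M} → x < M → y < M → peak x M y ≡ 1
peak-top x<M y<M rewrite <⇒<ᵇ≡true x<M | <⇒<ᵇ≡true y<M = refl

interiorPeaks-nonpeak : ∀ a b r → (a <ᵇ b) ≡ false → interiorPeaks (a ∷ b ∷ r) ≡ interiorPeaks (b ∷ r)
interiorPeaks-nonpeak a b []      a≮b = refl
interiorPeaks-nonpeak a b (c ∷ r) a≮b rewrite a≮b = refl

interiorPeaks-insert-front : ∀ {x y M} r → x < M → y < M →
  interiorPeaks (x ∷ M ∷ y ∷ r) ≡ suc (interiorPeaks (y ∷ r))
interiorPeaks-insert-front {y = y} {M} r x<M y<M = cong₂ ℕ._+_ (peak-top x<M y<M)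
  (interiorPeaks-nonpeak M y r (≤⇒<ᵇ≡false (ℕ.<⇒≤ y<M)))

interiorPeaks-insert-second : ∀ x {y M} r → y < M →
  interiorPeaks (x ∷ y ∷ M ∷ r) ≡ interiorPeaks (y ∷ M ∷ r)
interiorPeaks-insert-second x {y} r y<M = cong (ℕ._+ interiorPeaks (y ∷ _ ∷ r)) (peak-below x y y<M)

-- If a is a peak between c and b, then inserting M right after a moves that peak onto M.
peak-cases : ∀ c a b r {M} → a < M → b < M →
  peak c a b ≡ 0 ⊎ (peak c a b ≡ 1 × interiorPeaks (a ∷ M ∷ b ∷ r) ≡ suc (interiorPeaks (a ∷ b ∷ r)))
peak-cases c a b r a<M b<M with (c <ᵇ a) ∧ (b <ᵇ a) in isPeak
... | false = inj₁ refl
... | true  = inj₂ (refl , trans (interiorPeaks-insert-front r a<M b<M)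
                                 (cong suc (sym (interiorPeaks-nonpeak a b r (≤⇒<ᵇ≡false (ℕ.<⇒≤ b<a))))))
  where
  b<a : b < a
  b<a = ℕ.<ᵇ⇒< b a (proj₂ (Equivalence.to Bool.T-∧ (subst True (sym isPeak) _)))

peaks-after-prefix : ∀ c a b X →
  map (λ v → interiorPeaks (c ∷ v)) (map (a ∷_) (map (b ∷_) X))
    ≡ map (peak c a b ℕ.+_) (map (λ v → interiorPeaks (a ∷ v)) (map (b ∷_) X))
peaks-after-prefix c a b []      = refl
peaks-after-prefix c a b (v ∷ X) = cong (_ ∷_) (peaks-after-prefix c a b X)

interiorPeaks-inserts : ∀ M c w → All (_< M) (c ∷ w) →
  genPoly (map (λ v → interiorPeaks (c ∷ v)) (inserts M w))
    ≈P insertionPoly (interiorPeaks (c ∷ w)) (length w)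
interiorPeaks-inserts M c [] _ =
  solve 2 (λ X Y → Y :+ con (+ 0)
              := (con (+ 1) :+ con (+ 2) :* con (+ 0)) :* Y
                   :+ (con (+ 0) :+ :- (con (+ 2) :* con (+ 0))) :* (X :* Y))
    ≈P-refl XP (mono 0)
interiorPeaks-inserts M c (a ∷ []) (c<M ∷ a<M ∷ []) = begin
    genPoly (interiorPeaks (c ∷ M ∷ a ∷ []) ∷ interiorPeaks (c ∷ a ∷ M ∷ []) ∷ [])
  ≡⟨ cong genPoly (cong₂ (λ u v → u ∷ v ∷ [])
       (interiorPeaks-insert-front [] c<M a<M) (interiorPeaks-insert-second c [] a<M)) ⟩
    mono 1 ⊕ (mono 0 ⊕ 0P)
  ≈⟨ insertionPoly-step 0 0 0 0 [] (inj₁ refl) (interiorPeaks-inserts M a [] (a<M ∷ [])) ⟩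
    insertionPoly 0 1 ∎
  where open ≈P-Reasoning
interiorPeaks-inserts M c (a ∷ b ∷ r) (c<M ∷ a<M ∷ b<M ∷ r<M) = begin
    genPoly (map (λ v → interiorPeaks (c ∷ v)) (inserts M (a ∷ b ∷ r)))
  ≡⟨ cong genPoly (cong₂ _∷_ (interiorPeaks-insert-front (b ∷ r) c<M a<M)
       (cong₂ _∷_ (interiorPeaks-insert-second c (b ∷ r) a<M) (peaks-after-prefix c a b (inserts M r)))) ⟩
    mono (suc q) ⊕ (mono e ⊕ genPoly (map (peak c a b ℕ.+_) L))
  ≈⟨ insertionPoly-step (peak c a b) q (length (b ∷ r)) e L (peak-cases c a b r a<M b<M)
       (interiorPeaks-inserts M a (b ∷ r) (a<M ∷ b<M ∷ r<M)) ⟩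
    insertionPoly (interiorPeaks (c ∷ a ∷ b ∷ r)) (length (a ∷ b ∷ r)) ∎
  where
  open ≈P-Reasoning
  q = interiorPeaks (a ∷ b ∷ r)
  e = interiorPeaks (a ∷ M ∷ b ∷ r)
  L = map (λ v → interiorPeaks (a ∷ v)) (map (b ∷_) (inserts M r))

extPeaks≡interiorPeaks-0∷ : ∀ v → All (0 <_) v → extPeaks v ≡ interiorPeaks (0 ∷ v)
extPeaks≡interiorPeaks-0∷ []              _        = refl
extPeaks≡interiorPeaks-0∷ (a ∷ [])        _        = refl
extPeaks≡interiorPeaks-0∷ (suc a ∷ b ∷ r) _        = refl
extPeaks≡interiorPeaks-0∷ (zero ∷ b ∷ r)  (() ∷ _)

inserts-All : ∀ {P : ℕ → Set} {M} w → P M → All P w → All (All P) (inserts M w)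
inserts-All []      pM _          = (pM ∷ []) ∷ []
inserts-All (a ∷ w) pM (pa ∷ pw) =
  (pM ∷ pa ∷ pw) ∷ AllP.map⁺ (All.map (pa ∷_) (inserts-All w pM pw))

extPeaks-inserts : ∀ m π → length π ≡ m → All (λ a → 0 < a × a ≤ m) π →
  genPoly (map extPeaks (inserts (suc m) π)) ≈P (mono (extPeaks π) ⊕ Ψ m (mono (extPeaks π)))
extPeaks-inserts m π refl π-bounded = begin
    genPoly (map extPeaks (inserts (suc m) π))
  ≡⟨ cong genPoly (List.map-cong-local (All.map (λ {v} → extPeaks≡interiorPeaks-0∷ v)
       (inserts-All π (s≤s z≤n) (All.map proj₁ π-bounded)))) ⟩
    genPoly (map (λ v → interiorPeaks (0 ∷ v)) (inserts (suc m) π))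
  ≈⟨ interiorPeaks-inserts (suc m) 0 π (s≤s z≤n ∷ All.map (s≤s ∘ proj₂) π-bounded) ⟩
    insertionPoly (interiorPeaks (0 ∷ π)) m
  ≡⟨ cong (λ p → insertionPoly p m) (extPeaks≡interiorPeaks-0∷ π (All.map proj₁ π-bounded)) ⟨
    insertionPoly (extPeaks π) m
  ≈⟨ insertionPoly≈ (extPeaks π) m ⟩
    mono (extPeaks π) ⊕ Ψ m (mono (extPeaks π)) ∎
  where open ≈P-Reasoning

genPoly-concatMap : ∀ m (s : List ℕ → ℕ) (f : List ℕ → List (List ℕ)) L →
  All (λ π → genPoly (map s (f π)) ≈P (mono (s π) ⊕ Ψ m (mono (s π)))) L →
  genPoly (map s (concatMap f L)) ≈P (genPoly (map s L) ⊕ Ψ m (genPoly (map s L)))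
genPoly-concatMap m s f [] [] = begin
    0P              ≈⟨ solve 0 (con (+ 0) := con (+ 0) :+ con (+ 0)) ≈P-refl ⟩
    0P ⊕ 0P         ≈⟨ ⊕-congˡ 0P (Ψ-0P m) ⟨
    0P ⊕ Ψ m 0P     ∎
  where open ≈P-Reasoning
genPoly-concatMap m s f (π ∷ L) (gen-π ∷ gen-L) = begin
    genPoly (map s (f π ++ concatMap f L))
  ≡⟨ cong genPoly (List.map-++ s (f π) (concatMap f L)) ⟩
    genPoly (map s (f π) ++ map s (concatMap f L))
  ≈⟨ genPoly-++ (map s (f π)) (map s (concatMap f L)) ⟩
    genPoly (map s (f π)) ⊕ genPoly (map s (concatMap f L))
  ≈⟨ ⊕-cong gen-π (genPoly-concatMap m s f L gen-L) ⟩
    (Y ⊕ Ψ m Y) ⊕ (Z ⊕ Ψ m Z)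
  ≈⟨ solve 4 (λ Y Z A B → (Y :+ A) :+ (Z :+ B) := (Y :+ Z) :+ (A :+ B)) ≈P-refl Y Z (Ψ m Y) (Ψ m Z) ⟩
    (Y ⊕ Z) ⊕ (Ψ m Y ⊕ Ψ m Z)
  ≈⟨ ⊕-congˡ (Y ⊕ Z) (Ψ-⊕ m Y Z) ⟨
    (Y ⊕ Z) ⊕ Ψ m (Y ⊕ Z) ∎
  where
  open ≈P-Reasoning
  Y = mono (s π)
  Z = genPoly (map s L)

-- Permutations of [n + 1] from permutations of [n]

∈⇒elemᵇ : ∀ {x xs} → x ∈ xs → True (elemᵇ x xs)
∈⇒elemᵇ {x} (here refl) = Equivalence.from Bool.T-∨ (inj₁ (ℕ.≡⇒≡ᵇ x x refl))
∈⇒elemᵇ     (there x∈)  = Equivalence.from Bool.T-∨ (inj₂ (∈⇒elemᵇ x∈))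

elemᵇ⇒∈ : ∀ x xs → True (elemᵇ x xs) → x ∈ xs
elemᵇ⇒∈ x (y ∷ ys) x∈ᵇ with Equivalence.to Bool.T-∨ x∈ᵇ
... | inj₁ x≡ᵇy = here (ℕ.≡ᵇ⇒≡ x y x≡ᵇy)
... | inj₂ x∈ᵇ′ = there (elemᵇ⇒∈ x ys x∈ᵇ′)

distinctᵇ⇒Unique : ∀ w → True (distinctᵇ w) → Unique w
distinctᵇ⇒Unique []       _        = []
distinctᵇ⇒Unique (x ∷ xs) distinct with elemᵇ x xs in x∉ᵇ
... | false = AllP.¬Any⇒All¬ xs (λ x∈ → subst True x∉ᵇ (∈⇒elemᵇ x∈)) ∷ distinctᵇ⇒Unique xs distinct

Unique⇒distinctᵇ : ∀ {w} → Unique w → True (distinctᵇ w)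
Unique⇒distinctᵇ []                = _
Unique⇒distinctᵇ {x ∷ xs} (x∉ ∷ u) with elemᵇ x xs in x∈ᵇ
... | false = Unique⇒distinctᵇ u
... | true  = ⊥-elim (AllP.All¬⇒¬Any x∉ (elemᵇ⇒∈ x xs (subst True (sym x∈ᵇ) _)))

words⁻ : ∀ A m w → w ∈ words A m → length w ≡ m × All (_∈ A) w
words⁻ A zero    .[] (here refl) = refl , []
words⁻ A (suc m) w   w∈ with find (∈-concatMap⁻ (λ a → map (a ∷_) (words A m)) {xs = A} w∈)
... | a , a∈A , w∈′ with ∈-map⁻ (a ∷_) w∈′
... | w′ , w′∈ , refl with words⁻ A m w′ w′∈
... | len , w′⊆A = cong suc len , a∈A ∷ w′⊆A

words⁺ : ∀ A m w → length w ≡ m → All (_∈ A) w → w ∈ words A m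
words⁺ A zero    []      _   _            = here refl
words⁺ A (suc m) (a ∷ w) len (a∈A ∷ w⊆A) = ∈-concatMap⁺ (λ a → map (a ∷_) (words A m))
  (lose a∈A (∈-map⁺ (a ∷_) (words⁺ A m w (ℕ.suc-injective len) w⊆A)))

InRange : ℕ → ℕ → Set
InRange n a = 0 < a × a ≤ n

range1⁻ : ∀ {n a} → a ∈ range1 n → InRange n a
range1⁻ a∈ with ∈-applyUpTo⁻ suc a∈
... | i , i<n , refl = s≤s z≤n , i<n

range1⁺ : ∀ {n a} → InRange n a → a ∈ range1 n
range1⁺ {a = suc i} (_ , a≤n) = ∈-applyUpTo⁺ suc a≤n

IsPerm : ℕ → List ℕ → Set
IsPerm n w = length w ≡ n × All (InRange n) w × Unique w

perms⁻ : ∀ n w → w ∈ perms n → IsPerm n w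
perms⁻ n w w∈ with ∈-filter⁻ (T? ∘ distinctᵇ) {xs = words (range1 n) n} w∈
... | w∈words , distinct with words⁻ (range1 n) n w w∈words
... | len , w⊆range = len , All.map range1⁻ w⊆range , distinctᵇ⇒Unique w distinct

perms⁺ : ∀ n w → IsPerm n w → w ∈ perms n
perms⁺ n w (len , w-range , w-unique) = ∈-filter⁺ (T? ∘ distinctᵇ)
  (words⁺ (range1 n) n w len (All.map range1⁺ w-range)) (Unique⇒distinctᵇ w-unique)

-- A left inverse r of f separates the blocks of concatMap f.
concatMap-Unique : ∀ {B : Set} (f : B → List (List ℕ)) (r : List ℕ → B) L → Unique L →
  All (λ x → Unique (f x) × All (λ v → r v ≡ x) (f x)) L → Unique (concatMap f L)
concatMap-Unique f r []      _          _                        = []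
concatMap-Unique f r (x ∷ L) (x∉L ∷ uL) ((ufx , r∘fx) ∷ hL) =
  Unique.++⁺ ufx (concatMap-Unique f r L uL hL) disjoint
  where
  disjoint : Disjoint (f x) (concatMap f L)
  disjoint (v∈fx , v∈rest) with find (∈-concatMap⁻ f {xs = L} v∈rest)
  ... | y , y∈L , v∈fy = All.lookup x∉L y∈L
    (trans (sym (All.lookup r∘fx v∈fx)) (All.lookup (proj₂ (All.lookup hL y∈L)) v∈fy))

∷-injectiveʳ : ∀ {a : ℕ} {x y : List ℕ} → a ∷ x ≡ a ∷ y → x ≡ y
∷-injectiveʳ refl = refl

headOr0 : List ℕ → ℕ
headOr0 []      = 0
headOr0 (a ∷ _) = a

words-Unique : ∀ A m → Unique A → Unique (words A m)
words-Unique A zero    _  = [] ∷ []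
words-Unique A (suc m) uA = concatMap-Unique (λ a → map (a ∷_) (words A m)) headOr0 A uA
  (All.tabulate (λ _ → Unique.map⁺ ∷-injectiveʳ (words-Unique A m uA)
                     , AllP.map⁺ (All.tabulate (λ _ → refl))))

perms-Unique : ∀ n → Unique (perms n)
perms-Unique n = Unique.filter⁺ (T? ∘ distinctᵇ) (words-Unique (range1 n) n
  (Unique.applyUpTo⁺₁ suc n (λ i<j _ → ℕ.<⇒≢ i<j ∘ ℕ.suc-injective)))

delete : ℕ → List ℕ → List ℕ
delete M = filterᵇ (λ x → not (x ≡ᵇ M))

delete-cons : ∀ a {M} w → a ≢ M → delete M (a ∷ w) ≡ a ∷ delete M w
delete-cons a {M} w a≢M with a ≡ᵇ M in a≡ᵇM
... | false = refl
... | true  = ⊥-elim (a≢M (ℕ.≡ᵇ⇒≡ a M (subst True (sym a≡ᵇM) _)))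

delete-head : ∀ M w → delete M (M ∷ w) ≡ delete M w
delete-head M w rewrite Equivalence.to Bool.T-≡ (ℕ.≡⇒≡ᵇ M M refl) = refl

delete-fresh : ∀ M w → All (_≢ M) w → delete M w ≡ w
delete-fresh M []      _           = refl
delete-fresh M (a ∷ w) (a≢M ∷ w≢M) = trans (delete-cons a w a≢M) (cong (a ∷_) (delete-fresh M w w≢M))

inserts-delete : ∀ M w → All (_≢ M) w → All (λ v → delete M v ≡ w) (inserts M w)
inserts-delete M []      _           = delete-head M [] ∷ []
inserts-delete M (a ∷ w) (a≢M ∷ w≢M) = trans (delete-head M (a ∷ w)) (delete-fresh M (a ∷ w) (a≢M ∷ w≢M))
  ∷ AllP.map⁺ (All.map (λ {v} v↦w → trans (delete-cons a v a≢M) (cong (a ∷_) v↦w)) (inserts-delete M w w≢M))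

inserts-Unique : ∀ M w → All (_≢ M) w → Unique (inserts M w)
inserts-Unique M []      _           = [] ∷ []
inserts-Unique M (a ∷ w) (a≢M ∷ w≢M) =
  AllP.map⁺ (All.tabulate (λ _ M∷≡a∷ → a≢M (sym (ℕ.suc-injective (cong (suc ∘ headOr0) M∷≡a∷)))))
  ∷ Unique.map⁺ ∷-injectiveʳ (inserts-Unique M w w≢M)

inserts-↭ : ∀ M w {v} → v ∈ inserts M w → v ↭ M ∷ w
inserts-↭ M []      (here refl) = ↭.refl
inserts-↭ M (a ∷ w) (here refl) = ↭.refl
inserts-↭ M (a ∷ w) (there v∈) with ∈-map⁻ (a ∷_) v∈
... | v′ , v′∈ , refl = ↭.trans (↭.prep a (inserts-↭ M w v′∈)) (↭.swap a M ↭.refl)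

inserts-∋ : ∀ M u u′ → (u ++ M ∷ u′) ∈ inserts M (u ++ u′)
inserts-∋ M []      []       = here refl
inserts-∋ M []      (x ∷ u′) = here refl
inserts-∋ M (a ∷ u) u′       = there (∈-map⁺ (a ∷_) (inserts-∋ M u u′))

shrink : ∀ {m} xs → All (InRange (suc m)) xs → All (suc m ≢_) xs → All (InRange m) xs
shrink xs xs-range xs≢ = All.zipWith
  (λ { ((0<a , a≤1+m) , m+1≢a) → 0<a , ℕ.≤-pred (ℕ.≤∧≢⇒< a≤1+m (m+1≢a ∘ sym)) }) (xs-range , xs≢)

remove-top : ∀ m u₁ u₂ → Unique (u₁ ++ suc m ∷ u₂) → All (InRange (suc m)) (u₁ ++ suc m ∷ u₂) →
  Unique (u₁ ++ u₂) × All (InRange m) (u₁ ++ u₂)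
remove-top m u₁ u₂ unique range with Unique-resp-↭ (↭⇒↭ₛ (shift (suc m) u₁ u₂)) unique
... | m+1∉ ∷ unique′ = unique′ , shrink (u₁ ++ u₂) (All.tail (All-resp-↭ (shift (suc m) u₁ u₂) range)) m+1∉

unique-bounded-length : ∀ m w → Unique w → All (InRange m) w → length w ≤ m
unique-bounded-length zero    []      _      _                   = z≤n
unique-bounded-length zero    (a ∷ w) _      ((0<a , a≤0) ∷ _)   = ⊥-elim (ℕ.<⇒≱ 0<a a≤0)
unique-bounded-length (suc m) w       unique range with suc m ∈? w
... | no m+1∉w = ℕ.m≤n⇒m≤1+n (unique-bounded-length m w unique (shrink w range (AllP.¬Any⇒All¬ w m+1∉w)))
... | yes m+1∈w with ∈-∃++ m+1∈w
... | u₁ , u₂ , refl with remove-top m u₁ u₂ unique range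
... | unique′ , range′ = subst (_≤ suc m) (sym (↭-length (shift (suc m) u₁ u₂)))
                               (s≤s (unique-bounded-length m (u₁ ++ u₂) unique′ range′))

perms-suc-↭ : ∀ n → perms (suc n) ↭ concatMap (inserts (suc n)) (perms n)
perms-suc-↭ n = ∼bag⇒↭ (unique∧set⇒bag (perms-Unique (suc n)) inserts-unique (mk⇔ to from))
  where
  M = suc n
  fresh : ∀ {π} → π ∈ perms n → All (_≢ M) π
  fresh π∈ = All.map (λ (_ , a≤n) a≡M → ℕ.<-irrefl refl (subst (_≤ n) a≡M a≤n))
    (proj₁ (proj₂ (perms⁻ n _ π∈)))
  inserts-unique : Unique (concatMap (inserts M) (perms n))
  inserts-unique = concatMap-Unique (inserts M) (delete M) (perms n) (perms-Unique n)
    (All.tabulate (λ {π} π∈ → inserts-Unique M π (fresh π∈) , inserts-delete M π (fresh π∈)))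
  to : ∀ {w} → w ∈ perms M → w ∈ concatMap (inserts M) (perms n)
  to {w} w∈ with perms⁻ M w w∈
  ... | len , range , unique with M ∈? w
  ... | no M∉w = ⊥-elim (ℕ.<-irrefl refl (subst (_≤ n) len (unique-bounded-length n w unique
                                          (shrink w range (AllP.¬Any⇒All¬ w M∉w)))))
  ... | yes M∈w with ∈-∃++ M∈w
  ... | u₁ , u₂ , refl with remove-top n u₁ u₂ unique range
  ... | unique′ , range′ = ∈-concatMap⁺ (inserts M) (lose π∈ (inserts-∋ M u₁ u₂))
    where
    π∈ : (u₁ ++ u₂) ∈ perms n
    π∈ = perms⁺ n (u₁ ++ u₂)
      (ℕ.suc-injective (trans (sym (↭-length (shift M u₁ u₂))) len) , range′ , unique′)
  from : ∀ {w} → w ∈ concatMap (inserts M) (perms n) → w ∈ perms M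
  from {w} w∈ with find (∈-concatMap⁻ (inserts M) {xs = perms n} w∈)
  ... | π , π∈ , w∈inserts with perms⁻ n π π∈
  ... | len , range , unique = perms⁺ M w
    ( trans (↭-length w↭) (cong suc len)
    , All-resp-↭ (↭-sym w↭) ((s≤s z≤n , ℕ.≤-refl) ∷ All.map (λ (0<a , a≤n) → 0<a , ℕ.m≤n⇒m≤1+n a≤n) range)
    , Unique-resp-↭ (↭⇒↭ₛ (↭-sym w↭)) (All.map (_∘ sym) (fresh π∈) ∷ unique))
    where
    w↭ : w ↭ M ∷ π
    w↭ = inserts-↭ M π w∈inserts

-- The peak polynomials

Tpoly≈genPoly : ∀ n → Tpoly n ≈P genPoly (map extPeaks (perms n))
Tpoly≈genPoly n = genPoly-coeff extPeaks (perms n)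

Tpoly-zero : Tpoly 0 ≈P 1P
Tpoly-zero zero    = refl
Tpoly-zero (suc k) = refl

Tpoly-suc : ∀ m → Tpoly (suc m) ≈P (Tpoly m ⊕ Ψ m (Tpoly m))
Tpoly-suc m = begin
    Tpoly (suc m)
  ≈⟨ Tpoly≈genPoly (suc m) ⟩
    genPoly (map extPeaks (perms (suc m)))
  ≈⟨ genPoly-↭ (↭-map⁺ extPeaks (perms-suc-↭ m)) ⟩
    genPoly (map extPeaks (concatMap (inserts (suc m)) (perms m)))
  ≈⟨ genPoly-concatMap m extPeaks (inserts (suc m)) (perms m) (All.tabulate (λ {π} π∈ →
       let (len , range , _) = perms⁻ m π π∈ in extPeaks-inserts m π len range)) ⟩
    G ⊕ Ψ m G
  ≈⟨ ⊕-cong (≈P-sym (Tpoly≈genPoly m)) (Ψ-cong m (≈P-sym (Tpoly≈genPoly m))) ⟩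
    Tpoly m ⊕ Ψ m (Tpoly m) ∎
  where
  open ≈P-Reasoning
  G = genPoly (map extPeaks (perms m))

proposition4p2 : ∀ (n : ℕ) → n ≥ 1 → ∀ (k : ℕ) →
    Tpoly n k ≡ Σ1to n (λ j → (+ (n C j) * sgn (j ∸ 1)) · ((oneMinusX ^P (j / 2)) ⊛ Tpoly (n ∸ j))) k
proposition4p2 = BinomialInversion.binomial-identity Tpoly Tpoly-zero Tpoly-suc
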